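{- Let $G=(V,E)$ be a multigraph with weights $w:E\to\mathbb{R}$, let $f':V\to\mathbb{Z}_{\ge0}$ with $f'(v)\le\deg(v)$ for all $v$, let $F$ be an $f'$-factor, and let $C=E\setminus F$, which is an $f$-edge cover for $f(v)=\deg(v)-f'(v)$. Let $\Omega$ be a set of blossoms with respect to $F$, $y:V\to\mathbb{R}_{\ge0}$, $z:\Omega\to\mathbb{R}_{\ge0}$, and $\delta_1',\delta_2'\ge0$. Suppose $(F,\Omega,y,z)$ satisfy: (F1) for every $e\in E\setminus F$, $yz_F(e)\ge w(e)-\delta_1'$; (F2) for every $e\in F$, $yz_F(e)\le w(e)+\delta_2'$; (F3) for every $B\in\Omega$, $|F\cap(\gamma(B)\cup I_F(B))|=\left\lfloor\frac{f'(B)+|I_F(B)|}{2}\right\rfloor$; (F4) for every $v$ with $\deg_F(v)<f'(v)$, $y(v)=0$. Then $(C,\Omega,y,z)$ satisfy, with $\delta_1=\delta_2'$ and $\delta_2=\delta_1'$: (C1) for every $e\in E\setminus C$, $yz_C(e)\le w(e)+\delta_1$; (C2) for every $e\in C$, $yz_C(e)\ge w(e)-\delta_2$; (C3) for every $B\in\Omega$, $|C\cap(\gamma(B)\cup(\delta(B)\setminus I_C(B)))|=\left\lceil\frac{f(B)-|I_C(B)|}{2}\right\rceil$; (C4) for every $v$ with $\deg_C(v)>f(v)$, $y(v)=0$.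
   Context: Multigraphs may have parallel edges and loops; $\deg(v)$ is the degree of $v$ in $G$. For $S\subseteq V$, $\delta(S)$ is the set of edges with exactly one endpoint in $S$ and $\gamma(S)$ the set of edges with both endpoints in $S$; for $T\subseteq E$, $\delta_T(S)=\delta(S)\cap T$; $\deg_T(v)$ is the number of edges of $T$ incident to $v$; $g(S)=\sum_{v\in S}g(v)$ for a function $g$ on $V$. An $f'$-factor is $F\subseteq E$ with $\deg_F(v)\le f'(v)$ for all $v$; an $f$-edge cover is $C\subseteq E$ with $\deg_C(v)\ge f(v)$ for all $v$. Edges in $F$ are called matched, others unmatched. Blossoms (w.r.t. $F$): a blossom is a tuple $(B,E_B,\beta(B),\eta(B))$ with $B\subseteq V$, $E_B\subseteq E$, base vertex $\beta(B)\in B$, and base edge set $\eta(B)\subseteq\delta(\beta(B))\cap\delta(B)$ with $|\eta(B)|\le1$. A singleton $\{v\}$ is a (trivial) blossom with $E_B=\emptyset$, $\beta=v$, $\eta=\emptyset$. Inductively, if $B_0,\ldots,B_{l-1}$ are disjoint blossoms and $C_B=\langle e_0,\ldots,e_{l-1}\rangle$ is a closed walk with $e_i\in B_i\times B_{i+1\bmod l}$ such that (a) if $B_0$ is a singleton, $e_0$ and $e_{l-1}$ are both matched or both unmatched, and (b) for each $i\neq0$: if $B_i$ is a singleton exactly one of $e_{i-1},e_i$ is matched, and if $B_i$ is nontrivial then $\eta(B_i)$ is $\{e_{i-1}\}$ or $\{e_i\}$; then $B=\bigcup_iB_i$ is a blossom with $E_B=C_B\cup\bigcup_i E_{B_i}$,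 $\beta(B)=\beta(B_0)$, and $\eta(B)=\eta(B_0)$ if $B_0$ is nontrivial, while if $B_0$ is a singleton $\eta(B)$ is either empty or consists of one edge of $\delta(B)\cap\delta(B_0)$ whose matched/unmatched type is opposite to that of $e_0$ and $e_{l-1}$. For $B\in\Omega$: $I_F(B)=\delta_F(B)\oplus\eta(B)$ and $I_C(B)=\delta_C(B)\oplus\eta(B)$ ($\oplus$ is symmetric difference). For an edge $(u,v)$: $yz_F(u,v)=y(u)+y(v)+\sum_{B\in\Omega:(u,v)\in\gamma(B)\cup I_F(B)}z(B)$ and $yz_C(u,v)=y(u)+y(v)+\sum_{B\in\Omega:(u,v)\in\gamma(B)\cup(\delta(B)\setminus I_C(B))}z(B)$. -}

module Defs where

open import Data.Nat as ℕ using (ℕ; zero; suc; _∸_)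
open import Data.Nat.DivMod using (_%_; m%n<n)
open import Data.Integer as ℤ using (ℤ)
open import Data.Integer.DivMod as ℤDM using ()
open import Data.Bool using (Bool; true; false; _∧_; _∨_; _xor_; not; if_then_else_)
open import Data.Fin using (Fin; zero; suc; toℕ; fromℕ<; _≟_)
open import Data.Fin.Subset using (Subset; ∣_∣)
open import Data.Vec using (lookup; tabulate)
open import Data.Maybe using (Maybe; just; nothing)
open import Data.Product using (_×_; _,_; proj₁; proj₂)
open import Data.Sum using (_⊎_)
open import Data.Empty using (⊥)
open import Relation.Binary.PropositionalEquality using (_≡_; _≢_)
open import Relation.Nullary.Decidable using (⌊_⌋)

sumIf : {A : Set} (0# : A) (_+_ : A → A → A) {p : ℕ} →
        (Fin p → Bool) → (Fin p → A) → A
sumIf 0# _+_ {zero}  b g = 0#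
sumIf 0# _+_ {suc p} b g =
  if b zero then g zero + sumIf 0# _+_ (λ i → b (suc i)) (λ i → g (suc i))
            else sumIf 0# _+_ (λ i → b (suc i)) (λ i → g (suc i))

count : {p : ℕ} → (Fin p → Bool) → ℕ
count P = ∣ tabulate P ∣

sumOver : {n : ℕ} → Subset n → (Fin n → ℕ) → ℕ
sumOver S g = sumIf 0 ℕ._+_ (lookup S) g

-- ⌈ x / 2 ⌉ on integers (ℤ division by a positive divisor is floor division)
ceilHalf : ℤ → ℤ
ceilHalf x = ℤ.- ((ℤ.- x) ℤDM./ ℤ.+ 2)

next : {k : ℕ} → Fin (suc k) → Fin (suc k)
next {k} i = fromℕ< (m%n<n (suc (toℕ i)) (suc k))

prev : {k : ℕ} → Fin (suc k) → Fin (suc k)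
prev {k} i = fromℕ< (m%n<n (toℕ i ℕ.+ k) (suc k))

-- Multigraphs: vertices Fin n, edges Fin m, each edge has two endpoints
-- (equal endpoints = loop).  Vertex sets are Subset n, edge sets Subset m.

record Multigraph (n m : ℕ) : Set where
  field
    ends : Fin m → Fin n × Fin n

module _ {n m : ℕ} (G : Multigraph n m) where
  open Multigraph G

  eqF : {k : ℕ} → Fin k → Fin k → Bool
  eqF a b = ⌊ a ≟ b ⌋

  -- number of endpoints of e equal to v (a loop at v counts twice)
  incid : Fin n → Fin m → ℕ
  incid v e = (if eqF (proj₁ (ends e)) v then 1 else 0)
          ℕ.+ (if eqF (proj₂ (ends e)) v then 1 else 0)

  degIn : Subset m → Fin n → ℕ
  degIn T v = sumIf 0 ℕ._+_ (lookup T) (incid v)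

  deg : Fin n → ℕ
  deg v = sumIf 0 ℕ._+_ (λ _ → true) (incid v)

  inδ : Subset n → Fin m → Bool
  inδ S e = lookup S (proj₁ (ends e)) xor lookup S (proj₂ (ends e))

  inγ : Subset n → Fin m → Bool
  inγ S e = lookup S (proj₁ (ends e)) ∧ lookup S (proj₂ (ends e))

  data Blossom : Set where
    trivial : Fin n → Blossom
    -- compose k Bs es η₀ : sub-blossoms B_0..B_k (l = k+1), closed walk
    -- edges e_0..e_k, and η₀ = chosen base edge (only used when B_0 is trivial)
    compose : (k : ℕ) → (Fin (suc k) → Blossom) → (Fin (suc k) → Fin m) →
              Maybe (Fin m) → Blossom

  isTrivial : Blossom → Bool
  isTrivial (trivial _) = true
  isTrivial (compose _ _ _ _) = false

  verts : Blossom → Subset n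
  verts (trivial v) = tabulate (λ u → eqF u v)
  verts (compose k Bs es η₀) = tabulate (λ u → anyFin (λ i → lookup (verts (Bs i)) u))
    where
    anyFin : {q : ℕ} → (Fin q → Bool) → Bool
    anyFin {zero} P = false
    anyFin {suc q} P = P zero ∨ anyFin (λ i → P (suc i))

  bedges : Blossom → Subset m
  bedges (trivial v) = tabulate (λ _ → false)
  bedges (compose k Bs es η₀) =
    tabulate (λ e → anyFin (λ i → eqF (es i) e) ∨ anyFin (λ i → lookup (bedges (Bs i)) e))
    where
    anyFin : {q : ℕ} → (Fin q → Bool) → Bool
    anyFin {zero} P = false
    anyFin {suc q} P = P zero ∨ anyFin (λ i → P (suc i))

  base : Blossom → Fin n
  base (trivial v) = v
  base (compose k Bs es η₀) = base (Bs zero)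

  -- base edge set η(B) (empty = nothing, {e} = just e)
  baseEdge : Blossom → Maybe (Fin m)
  baseEdge (trivial v) = nothing
  baseEdge (compose k Bs es η₀) with Bs zero
  ... | trivial _ = η₀
  ... | B₀@(compose _ _ _ _) = baseEdge B₀

  tuple : Blossom → Subset n × Subset m × Fin n × Maybe (Fin m)
  tuple B = verts B , bedges B , base B , baseEdge B

  joins : Subset n → Subset n → Fin m → Set
  joins S T e = (lookup S (proj₁ (ends e)) ≡ true × lookup T (proj₂ (ends e)) ≡ true)
              ⊎ (lookup S (proj₂ (ends e)) ≡ true × lookup T (proj₁ (ends e)) ≡ true)

  data IsBlossom (F : Subset m) : Blossom → Set where
    trivialB : (v : Fin n) → IsBlossom F (trivial v)
    composeB : (k : ℕ) (Bs : Fin (suc k) → Blossom) (es : Fin (suc k) → Fin m)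
               (η₀ : Maybe (Fin m)) →
      ((i : Fin (suc k)) → IsBlossom F (Bs i)) →
      ((i j : Fin (suc k)) → i ≢ j → (v : Fin n) →
         lookup (verts (Bs i)) v ≡ true → lookup (verts (Bs j)) v ≡ true → ⊥) →
      ((i : Fin (suc k)) → joins (verts (Bs i)) (verts (Bs (next i))) (es i)) →
      (isTrivial (Bs zero) ≡ true → lookup F (es zero) ≡ lookup F (es (prev zero))) →
      ((i : Fin (suc k)) → i ≢ zero →
         (isTrivial (Bs i) ≡ true → not (lookup F (es (prev i))) ≡ lookup F (es i))
         × (isTrivial (Bs i) ≡ false →
              (baseEdge (Bs i) ≡ just (es (prev i))) ⊎ (baseEdge (Bs i) ≡ just (es i)))) →
      (isTrivial (Bs zero) ≡ true → (e : Fin m) → η₀ ≡ just e →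
         (inδ (verts (compose k Bs es η₀)) e ≡ true)
         × (inδ (verts (Bs zero)) e ≡ true)
         × (lookup F e ≡ not (lookup F (es zero)))) →
      -- when B_0 is nontrivial, η(B) = η(B_0) and η₀ is unused (normalised)
      (isTrivial (Bs zero) ≡ false → η₀ ≡ nothing) →
      ((e : Fin m) → baseEdge (compose k Bs es η₀) ≡ just e →
         (inδ (verts (compose k Bs es η₀)) e ≡ true)
         × (inδ (tabulate (λ u → eqF u (base (compose k Bs es η₀)))) e ≡ true)) →
      IsBlossom F (compose k Bs es η₀)

  isη : Blossom → Fin m → Bool
  isη B e with baseEdge B
  ... | nothing = false
  ... | just e' = eqF e' e

  inI : Subset m → Blossom → Fin m → Bool
  inI T B e = (inδ (verts B) e ∧ lookup T e) xor isη B e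

  module Duals {R : Set} (0# : R) (_+_ : R → R → R)
               {p : ℕ} (Ω : Fin p → Blossom) (y : Fin n → R) (z : Fin p → R) where

    yzF : Subset m → Fin m → R
    yzF F e = (y (proj₁ (ends e)) + y (proj₂ (ends e)))
            + sumIf 0# _+_ (λ j → inγ (verts (Ω j)) e ∨ inI F (Ω j) e) z

    yzC : Subset m → Fin m → R
    yzC C e = (y (proj₁ (ends e)) + y (proj₂ (ends e)))
            + sumIf 0# _+_ (λ j → inγ (verts (Ω j)) e
                                  ∨ (inδ (verts (Ω j)) e ∧ not (inI C (Ω j) e))) z

-- Since η(B) ⊆ δ(B) and C = E ∖ F, the sets I_C(B) and I_F(B) partition δ(B), so
-- γ(B) ∪ (δ(B) ∖ I_C(B)) = γ(B) ∪ I_F(B): yz_C and yz_F coincide and (F1), (F2) become (C2), (C1).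
-- For (C3), the C- and F-edges of γ(B) ∪ I_F(B) together number |γ(B)| + |I_F(B)|, and
-- f(B) + f′(B) = Σ_{v ∈ B} deg v = 2|γ(B)| + |δ(B)| = 2|γ(B)| + |I_C(B)| + |I_F(B)|; hence
-- 2⌊(f′(B) + |I_F(B)|)/2⌋ + r = f′(B) + |I_F(B)| with r ∈ {0,1} turns into 2Y + |I_C(B)| = f(B) + r,
-- i.e. Y = ⌈(f(B) − |I_C(B)|)/2⌉. (C4) is (F4), because deg_C(v) = deg(v) − deg_F(v).
module Submission where

open import Defs
open import Data.Nat using (ℕ; zero; suc; s≤s; NonZero; _≤_; _<_; _/_; _+_; _*_; _∸_)
open import Data.Nat.DivMod using (_%_; m%n<n; m≡m%n+[m/n]*n; m*n%n≡0; m*n/n≡m; [m+kn]%n≡m%n; +-distrib-/)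
import Data.Nat.Properties as ℕ
open import Data.Nat.Tactic.RingSolver using (solve)
open import Data.List using ([]; _∷_)
open import Data.Integer as ℤ using (+_; -[1+_]; _-_; _⊖_)
open import Data.Integer.DivMod using (div-pos-is-/ℕ)
import Data.Integer.Properties as ℤ
open import Data.Bool using (Bool; true; false; _∧_; _∨_; not; _xor_; if_then_else_)
open import Data.Bool.Properties using (not-involutive; not-injective; not-distribˡ-xor)
open import Data.Fin using (Fin; zero; suc; _≟_)
open import Data.Fin.Subset using (Subset; ∁)
open import Data.Vec using (lookup)
open import Data.Vec.Properties using (lookup-map)
open import Data.Maybe using (just)
open import Data.Empty using (⊥; ⊥-elim)
open import Data.Product using (_×_; _,_; proj₁; proj₂)
open import Function.Base using (_∘_)
open import Function.Definitions using (Injective)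
open import Relation.Binary.PropositionalEquality
open import Relation.Nullary.Decidable using (⌊_⌋; yes; no)
open import Algebra.Properties.Semiring.Sum ℕ.+-*-semiring
  using (sum-syntax; sum-cong-≗; sum-replicate-zero; ∑-distrib-+; ∑-comm; *-distribˡ-sum; *-distribʳ-sum)

⟦_⟧ : Bool → ℕ
⟦ b ⟧ = if b then 1 else 0

count≡∑ : ∀ {k} (P : Fin k → Bool) → count P ≡ ∑[ i < k ] ⟦ P i ⟧
count≡∑ {zero}  P = refl
count≡∑ {suc k} P with P zero
... | true  = cong suc (count≡∑ (P ∘ suc))
... | false = count≡∑ (P ∘ suc)

count-+ : ∀ {k} (P Q R : Fin k → Bool) → (∀ i → ⟦ P i ⟧ + ⟦ Q i ⟧ ≡ ⟦ R i ⟧) →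
          count P + count Q ≡ count R
count-+ {k} P Q R pointwise = begin
  count P + count Q                          ≡⟨ cong₂ _+_ (count≡∑ P) (count≡∑ Q) ⟩
  ∑[ i < k ] ⟦ P i ⟧ + ∑[ i < k ] ⟦ Q i ⟧    ≡⟨ ∑-distrib-+ (⟦_⟧ ∘ P) (⟦_⟧ ∘ Q) ⟨
  ∑[ i < k ] (⟦ P i ⟧ + ⟦ Q i ⟧)             ≡⟨ sum-cong-≗ pointwise ⟩
  ∑[ i < k ] ⟦ R i ⟧                         ≡⟨ count≡∑ R ⟨
  count R                                    ∎
  where open ≡-Reasoning

sumIf≡∑ : ∀ {k} (b : Fin k → Bool) (g : Fin k → ℕ) →
          sumIf 0 _+_ b g ≡ ∑[ i < k ] (⟦ b i ⟧ * g i)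
sumIf≡∑ {zero}  b g = refl
sumIf≡∑ {suc k} b g with b zero
... | true  = cong₂ _+_ (sym (ℕ.*-identityˡ (g zero))) (sumIf≡∑ (b ∘ suc) (g ∘ suc))
... | false = sumIf≡∑ (b ∘ suc) (g ∘ suc)

sumIf-cong : {A : Set} (0# : A) (_⊕_ : A → A → A) {k : ℕ} {b b′ : Fin k → Bool} (g : Fin k → A) →
             (∀ i → b i ≡ b′ i) → sumIf 0# _⊕_ b g ≡ sumIf 0# _⊕_ b′ g
sumIf-cong 0# _⊕_ {zero}  g b≗b′ = refl
sumIf-cong 0# _⊕_ {suc k} {b} {b′} g b≗b′ rewrite b≗b′ zero
  | sumIf-cong 0# _⊕_ {b = b ∘ suc} {b′ ∘ suc} (g ∘ suc) (b≗b′ ∘ suc) = refl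

sumOver-∸+ : ∀ {k} (S : Subset k) {g h : Fin k → ℕ} → (∀ v → g v ≤ h v) →
             sumOver S (λ v → h v ∸ g v) + sumOver S g ≡ sumOver S h
sumOver-∸+ {k} S {g} {h} g≤h = begin
  sumOver S (λ v → h v ∸ g v) + sumOver S g
    ≡⟨ cong₂ _+_ (sumIf≡∑ (lookup S) _) (sumIf≡∑ (lookup S) g) ⟩
  ∑[ v < k ] (⟦ lookup S v ⟧ * (h v ∸ g v)) + ∑[ v < k ] (⟦ lookup S v ⟧ * g v)
    ≡⟨ ∑-distrib-+ (λ v → ⟦ lookup S v ⟧ * (h v ∸ g v)) (λ v → ⟦ lookup S v ⟧ * g v) ⟨
  ∑[ v < k ] (⟦ lookup S v ⟧ * (h v ∸ g v) + ⟦ lookup S v ⟧ * g v)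
    ≡⟨ sum-cong-≗ (λ v → trans (sym (ℕ.*-distribˡ-+ ⟦ lookup S v ⟧ _ _))
                               (cong (⟦ lookup S v ⟧ *_) (ℕ.m∸n+n≡m (g≤h v)))) ⟩
  ∑[ v < k ] (⟦ lookup S v ⟧ * h v)
    ≡⟨ sumIf≡∑ (lookup S) h ⟨
  sumOver S h ∎
  where open ≡-Reasoning

∑-pick : ∀ {k} (g : Fin k → ℕ) (a : Fin k) → ∑[ v < k ] (⟦ ⌊ a ≟ v ⌋ ⟧ * g v) ≡ g a
∑-pick {suc k} g zero =
  trans (cong₂ _+_ (ℕ.*-identityˡ (g zero)) (sum-replicate-zero k)) (ℕ.+-identityʳ (g zero))
∑-pick {suc k} g (suc a) =
  trans (sum-cong-≗ (λ v → cong (λ b → ⟦ b ⟧ * g (suc v)) (suc≟suc a v))) (∑-pick (g ∘ suc) a)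
  where
  suc≟suc : ∀ {k} (a v : Fin k) → ⌊ suc a ≟ suc v ⌋ ≡ ⌊ a ≟ v ⌋
  suc≟suc a v with a ≟ v
  ... | yes _ = refl
  ... | no  _ = refl

-[1+n]/ℕd-exact : ∀ n d .{{_ : NonZero d}} → suc n % d ≡ 0 → -[1+ n ] ℤ./ℕ d ≡ ℤ.- + (suc n / d)
-[1+n]/ℕd-exact n d d∣1+n rewrite d∣1+n = refl

-[1+n]/ℕd-inexact : ∀ n d .{{_ : NonZero d}} r → suc n % d ≡ suc r → -[1+ n ] ℤ./ℕ d ≡ -[1+ suc n / d ]
-[1+n]/ℕd-inexact n d r d∤1+n rewrite d∤1+n = refl

[r⊖q*2]/2≡-q : ∀ r q → r < 2 → (r ⊖ q * 2) ℤ./ + 2 ≡ ℤ.- + q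
[r⊖q*2]/2≡-q 0 zero    _ = refl
[r⊖q*2]/2≡-q 1 zero    _ = refl
[r⊖q*2]/2≡-q 0 (suc k) _ = begin
  -[1+ suc (k * 2) ] ℤ./ + 2   ≡⟨ div-pos-is-/ℕ -[1+ suc (k * 2) ] 2 ⟩
  -[1+ suc (k * 2) ] ℤ./ℕ 2    ≡⟨ -[1+n]/ℕd-exact (suc (k * 2)) 2 (m*n%n≡0 (suc k) 2) ⟩
  ℤ.- + (suc k * 2 / 2)        ≡⟨ cong (ℤ.-_ ∘ +_) (m*n/n≡m (suc k) 2) ⟩
  ℤ.- + suc k                  ∎
  where open ≡-Reasoning
[r⊖q*2]/2≡-q 1 (suc k) _ = begin
  -[1+ k * 2 ] ℤ./ + 2         ≡⟨ div-pos-is-/ℕ -[1+ k * 2 ] 2 ⟩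
  -[1+ k * 2 ] ℤ./ℕ 2          ≡⟨ -[1+n]/ℕd-inexact (k * 2) 2 0 ([m+kn]%n≡m%n 1 k 2) ⟩
  -[1+ (1 + k * 2) / 2 ]       ≡⟨ cong -[1+_] [1+k*2]/2≡k ⟩
  -[1+ k ]                     ∎
  where
  open ≡-Reasoning
  [1+k*2]/2≡k : (1 + k * 2) / 2 ≡ k
  [1+k*2]/2≡k = trans (+-distrib-/ 1 (k * 2) (subst (λ x → 1 + x < 2) (sym (m*n%n≡0 k 2)) ℕ.≤-refl))
                      (m*n/n≡m k 2)
[r⊖q*2]/2≡-q (suc (suc _)) _ (s≤s (s≤s ()))

q*2+b≡a+r⇒ceilHalf[a-b]≡q : ∀ a b q r → r < 2 → q * 2 + b ≡ a + r → ceilHalf (+ a - + b) ≡ + q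
q*2+b≡a+r⇒ceilHalf[a-b]≡q a b q r r<2 q*2+b≡a+r = begin
  ℤ.- ((ℤ.- (+ a - + b)) ℤ./ + 2)  ≡⟨ cong (λ i → ℤ.- (i ℤ./ + 2)) -[a-b]≡r⊖q*2 ⟩
  ℤ.- ((r ⊖ q * 2) ℤ./ + 2)        ≡⟨ cong ℤ.-_ ([r⊖q*2]/2≡-q r q r<2) ⟩
  ℤ.- (ℤ.- + q)                    ≡⟨ ℤ.neg-involutive (+ q) ⟩
  + q                              ∎
  where
  open ≡-Reasoning
  -[a-b]≡r⊖q*2 : ℤ.- (+ a - + b) ≡ r ⊖ q * 2
  -[a-b]≡r⊖q*2 = begin
    ℤ.- (+ a - + b)        ≡⟨ cong ℤ.-_ (ℤ.[+m]-[+n]≡m⊖n a b) ⟩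
    ℤ.- (a ⊖ b)            ≡⟨ ℤ.⊖-swap b a ⟨
    b ⊖ a                  ≡⟨ ℤ.+-cancelˡ-⊖ r b a ⟨
    (r + b) ⊖ (r + a)      ≡⟨ cong₂ _⊖_ (ℕ.+-comm r b) (trans (ℕ.+-comm r a) (trans (sym q*2+b≡a+r) (ℕ.+-comm (q * 2) b))) ⟩
    (b + r) ⊖ (b + q * 2)  ≡⟨ ℤ.+-cancelˡ-⊖ b r (q * 2) ⟩
    r ⊖ q * 2              ∎

-- Y, X: the C- and F-sides of (C3), (F3); g, i, c, d: |γ(B)|, |I_F(B)|, |I_C(B)|, |δ(B)|; a, a′: f(B), f′(B).
balance : ∀ {Y X g i c d a a′ r} → Y + X ≡ g + i → c + i ≡ d → a + a′ ≡ g * 2 + d →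
          X * 2 + r ≡ a′ + i → Y * 2 + c ≡ a + r
balance {Y} {X} {g} {i} {c} {d} {a} {a′} {r} Y+X≡g+i c+i≡d a+a′≡2g+d X*2+r≡a′+i =
  ℕ.+-cancelʳ-≡ (a′ + i) (Y * 2 + c) (a + r) (begin
    Y * 2 + c + (a′ + i)       ≡⟨ cong (λ x → Y * 2 + c + x) X*2+r≡a′+i ⟨
    Y * 2 + c + (X * 2 + r)    ≡⟨ solve (Y ∷ X ∷ c ∷ r ∷ []) ⟩
    (Y + X) * 2 + (c + r)      ≡⟨ cong (λ x → x * 2 + (c + r)) Y+X≡g+i ⟩
    (g + i) * 2 + (c + r)      ≡⟨ solve (g ∷ i ∷ c ∷ r ∷ []) ⟩
    g * 2 + (c + i) + (i + r)  ≡⟨ cong (λ x → g * 2 + x + (i + r)) c+i≡d ⟩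
    g * 2 + d + (i + r)        ≡⟨ cong (_+ (i + r)) a+a′≡2g+d ⟨
    a + a′ + (i + r)           ≡⟨ solve (a ∷ a′ ∷ i ∷ r ∷ []) ⟩
    a + r + (a′ + i)           ∎)
  where open ≡-Reasoning

⟦x⟧+⟦y⟧≡⟦x∧y⟧*2+⟦x⊕y⟧ : ∀ x y → ⟦ x ⟧ + ⟦ y ⟧ ≡ ⟦ x ∧ y ⟧ * 2 + ⟦ x xor y ⟧
⟦x⟧+⟦y⟧≡⟦x∧y⟧*2+⟦x⊕y⟧ true  true  = refl
⟦x⟧+⟦y⟧≡⟦x∧y⟧*2+⟦x⊕y⟧ true  false = refl
⟦x⟧+⟦y⟧≡⟦x∧y⟧*2+⟦x⊕y⟧ false true  = refl
⟦x⟧+⟦y⟧≡⟦x∧y⟧*2+⟦x⊕y⟧ false false = refl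

⟦x⟧+⟦not-x⟧≡1 : ∀ x → ⟦ x ⟧ + ⟦ not x ⟧ ≡ 1
⟦x⟧+⟦not-x⟧≡1 true  = refl
⟦x⟧+⟦not-x⟧≡1 false = refl

⟦not-x∧y⟧+⟦x∧y⟧≡⟦y⟧ : ∀ x y → ⟦ not x ∧ y ⟧ + ⟦ x ∧ y ⟧ ≡ ⟦ y ⟧
⟦not-x∧y⟧+⟦x∧y⟧≡⟦y⟧ true  y = refl
⟦not-x∧y⟧+⟦x∧y⟧≡⟦y⟧ false y = ℕ.+-identityʳ ⟦ y ⟧

⟦x∨y⟧≡⟦x⟧+⟦y⟧ : ∀ x y → (x ≡ true → y ≡ true → ⊥) → ⟦ x ∨ y ⟧ ≡ ⟦ x ⟧ + ⟦ y ⟧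
⟦x∨y⟧≡⟦x⟧+⟦y⟧ true  true  x∩y≡∅ = ⊥-elim (x∩y≡∅ refl refl)
⟦x∨y⟧≡⟦x⟧+⟦y⟧ true  false _     = refl
⟦x∨y⟧≡⟦x⟧+⟦y⟧ false y     _     = refl

x∧y⇒¬x⊕y : ∀ x y → x ∧ y ≡ true → x xor y ≡ false
x∧y⇒¬x⊕y true true _ = refl

-- Membership of an edge e in I_T(B) is (d ∧ t) xor h, where d = [e ∈ δ(B)], t = [e ∈ T]
-- and h = [e ∈ η(B)]; the hypothesis h ⇒ d is η(B) ⊆ δ(B).

I⊆δᵇ : ∀ d t h → (h ≡ true → d ≡ true) → (d ∧ t) xor h ≡ true → d ≡ true
I⊆δᵇ true  t h _   _ = refl
I⊆δᵇ false t h h⇒d I = h⇒d I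

δ∖I∁≡Iᵇ : ∀ d t h → (h ≡ true → d ≡ true) → d ∧ not ((d ∧ not t) xor h) ≡ (d ∧ t) xor h
δ∖I∁≡Iᵇ true  t h     _   = trans (not-distribˡ-xor (not t) h) (cong (_xor h) (not-involutive t))
δ∖I∁≡Iᵇ false t false _   = refl
δ∖I∁≡Iᵇ false t true  h⇒d with () ← h⇒d refl

I∁+I≡δᵇ : ∀ d t h → (h ≡ true → d ≡ true) → ⟦ (d ∧ not t) xor h ⟧ + ⟦ (d ∧ t) xor h ⟧ ≡ ⟦ d ⟧
I∁+I≡δᵇ true  true  true  _ = refl
I∁+I≡δᵇ true  true  false _ = refl
I∁+I≡δᵇ true  false true  _ = refl
I∁+I≡δᵇ true  false false _ = refl
I∁+I≡δᵇ false t     false _ = refl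
I∁+I≡δᵇ false t     true  h⇒d with () ← h⇒d refl

lookup-∁ : ∀ {k} (F : Subset k) e b → lookup (∁ F) e ≡ not b → lookup F e ≡ b
lookup-∁ F e b ∁F[e]≡not-b = not-injective (trans (sym (lookup-map e not F)) ∁F[e]≡not-b)

module _ {n m : ℕ} (G : Multigraph n m) where
  open Multigraph G

  degIn+degIn∁≡deg : ∀ (F : Subset m) v → degIn G F v + degIn G (∁ F) v ≡ deg G v
  degIn+degIn∁≡deg F v = begin
    degIn G F v + degIn G (∁ F) v
      ≡⟨ cong₂ _+_ (sumIf≡∑ (lookup F) (incid G v)) (sumIf≡∑ (lookup (∁ F)) (incid G v)) ⟩
    ∑[ e < m ] (⟦ lookup F e ⟧ * incid G v e) + ∑[ e < m ] (⟦ lookup (∁ F) e ⟧ * incid G v e)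
      ≡⟨ ∑-distrib-+ (λ e → ⟦ lookup F e ⟧ * incid G v e) (λ e → ⟦ lookup (∁ F) e ⟧ * incid G v e) ⟨
    ∑[ e < m ] (⟦ lookup F e ⟧ * incid G v e + ⟦ lookup (∁ F) e ⟧ * incid G v e)
      ≡⟨ sum-cong-≗ split ⟩
    ∑[ e < m ] (⟦ true ⟧ * incid G v e)
      ≡⟨ sumIf≡∑ (λ _ → true) (incid G v) ⟨
    deg G v ∎
    where
    open ≡-Reasoning
    split : ∀ e → ⟦ lookup F e ⟧ * incid G v e + ⟦ lookup (∁ F) e ⟧ * incid G v e ≡ 1 * incid G v e
    split e = begin
      ⟦ lookup F e ⟧ * incid G v e + ⟦ lookup (∁ F) e ⟧ * incid G v e
        ≡⟨ ℕ.*-distribʳ-+ (incid G v e) ⟦ lookup F e ⟧ _ ⟨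
      (⟦ lookup F e ⟧ + ⟦ lookup (∁ F) e ⟧) * incid G v e
        ≡⟨ cong (λ x → (⟦ lookup F e ⟧ + ⟦ x ⟧) * incid G v e) (lookup-map e not F) ⟩
      (⟦ lookup F e ⟧ + ⟦ not (lookup F e) ⟧) * incid G v e
        ≡⟨ cong (_* incid G v e) (⟦x⟧+⟦not-x⟧≡1 (lookup F e)) ⟩
      1 * incid G v e ∎

  ∑-incid : ∀ (S : Subset n) e → ∑[ v < n ] (⟦ lookup S v ⟧ * incid G v e)
            ≡ ⟦ lookup S (proj₁ (ends e)) ⟧ + ⟦ lookup S (proj₂ (ends e)) ⟧
  ∑-incid S e = begin
    ∑[ v < n ] (⟦ lookup S v ⟧ * incid G v e)
      ≡⟨ sum-cong-≗ (λ v → ℕ.*-distribˡ-+ ⟦ lookup S v ⟧ (⟦ eqF G a v ⟧) (⟦ eqF G b v ⟧)) ⟩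
    ∑[ v < n ] (⟦ lookup S v ⟧ * ⟦ eqF G a v ⟧ + ⟦ lookup S v ⟧ * ⟦ eqF G b v ⟧)
      ≡⟨ ∑-distrib-+ (λ v → ⟦ lookup S v ⟧ * ⟦ eqF G a v ⟧) (λ v → ⟦ lookup S v ⟧ * ⟦ eqF G b v ⟧) ⟩
    ∑[ v < n ] (⟦ lookup S v ⟧ * ⟦ eqF G a v ⟧) + ∑[ v < n ] (⟦ lookup S v ⟧ * ⟦ eqF G b v ⟧)
      ≡⟨ cong₂ _+_ (pick a) (pick b) ⟩
    ⟦ lookup S a ⟧ + ⟦ lookup S b ⟧ ∎
    where
    open ≡-Reasoning
    a b : Fin n
    a = proj₁ (ends e)
    b = proj₂ (ends e)
    pick : ∀ u → ∑[ v < n ] (⟦ lookup S v ⟧ * ⟦ eqF G u v ⟧) ≡ ⟦ lookup S u ⟧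
    pick u = trans (sum-cong-≗ (λ v → ℕ.*-comm ⟦ lookup S v ⟧ _)) (∑-pick (λ v → ⟦ lookup S v ⟧) u)

  sumOver-deg : ∀ (S : Subset n) → sumOver S (deg G) ≡ count (inγ G S) * 2 + count (inδ G S)
  sumOver-deg S = begin
    sumOver S (deg G)
      ≡⟨ sumIf≡∑ (lookup S) (deg G) ⟩
    ∑[ v < n ] (⟦ lookup S v ⟧ * deg G v)
      ≡⟨ sum-cong-≗ (λ v → cong (⟦ lookup S v ⟧ *_) (deg≡∑ v)) ⟩
    ∑[ v < n ] (⟦ lookup S v ⟧ * ∑[ e < m ] incid G v e)
      ≡⟨ sum-cong-≗ (λ v → *-distribˡ-sum ⟦ lookup S v ⟧ (incid G v)) ⟩
    ∑[ v < n ] ∑[ e < m ] (⟦ lookup S v ⟧ * incid G v e)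
      ≡⟨ ∑-comm (λ v e → ⟦ lookup S v ⟧ * incid G v e) ⟩
    ∑[ e < m ] ∑[ v < n ] (⟦ lookup S v ⟧ * incid G v e)
      ≡⟨ sum-cong-≗ (λ e → trans (∑-incid S e)
                                 (⟦x⟧+⟦y⟧≡⟦x∧y⟧*2+⟦x⊕y⟧ (lookup S (proj₁ (ends e))) (lookup S (proj₂ (ends e))))) ⟩
    ∑[ e < m ] (⟦ inγ G S e ⟧ * 2 + ⟦ inδ G S e ⟧)
      ≡⟨ ∑-distrib-+ (λ e → ⟦ inγ G S e ⟧ * 2) (λ e → ⟦ inδ G S e ⟧) ⟩
    ∑[ e < m ] (⟦ inγ G S e ⟧ * 2) + ∑[ e < m ] ⟦ inδ G S e ⟧
      ≡⟨ cong (_+ ∑[ e < m ] ⟦ inδ G S e ⟧) (*-distribʳ-sum 2 (λ e → ⟦ inγ G S e ⟧)) ⟨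
    ∑[ e < m ] ⟦ inγ G S e ⟧ * 2 + ∑[ e < m ] ⟦ inδ G S e ⟧
      ≡⟨ cong₂ (λ x y → x * 2 + y) (count≡∑ (inγ G S)) (count≡∑ (inδ G S)) ⟨
    count (inγ G S) * 2 + count (inδ G S) ∎
    where
    open ≡-Reasoning
    deg≡∑ : ∀ v → deg G v ≡ ∑[ e < m ] incid G v e
    deg≡∑ v = trans (sumIf≡∑ (λ _ → true) (incid G v)) (sum-cong-≗ (λ e → ℕ.*-identityˡ (incid G v e)))

  isη⇒baseEdge : ∀ B e → isη G B e ≡ true → baseEdge G B ≡ just e
  isη⇒baseEdge B e e∈η with baseEdge G B
  ... | just e′ with e′ ≟ e
  ...   | yes e′≡e = cong just e′≡e

  η⊆δ : ∀ {F B} → IsBlossom G F B → ∀ e → isη G B e ≡ true → inδ G (verts G B) e ≡ true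
  η⊆δ (trivialB v) e ()
  η⊆δ (composeB k Bs es η₀ _ _ _ _ _ _ _ η⊆δ∩δβ) e e∈η =
    proj₁ (η⊆δ∩δβ e (isη⇒baseEdge (compose k Bs es η₀) e e∈η))

  module _ {F : Subset m} {B : Blossom G} (isB : IsBlossom G F B) where
    private
      S : Subset n
      S = verts G B

    I⊆δ : ∀ T e → inI G T B e ≡ true → inδ G S e ≡ true
    I⊆δ T e = I⊆δᵇ (inδ G S e) (lookup T e) (isη G B e) (η⊆δ isB e)

    γ∪δ∖I∁≡γ∪I : ∀ e → (inγ G S e ∨ (inδ G S e ∧ not (inI G (∁ F) B e))) ≡ (inγ G S e ∨ inI G F B e)
    γ∪δ∖I∁≡γ∪I e = cong (inγ G S e ∨_) δ∖I∁≡I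
      where
      δ∖I∁≡I : inδ G S e ∧ not (inI G (∁ F) B e) ≡ inI G F B e
      δ∖I∁≡I rewrite lookup-map e not F = δ∖I∁≡Iᵇ (inδ G S e) (lookup F e) (isη G B e) (η⊆δ isB e)

    count-I∁+count-I≡count-δ : count (inI G (∁ F) B) + count (inI G F B) ≡ count (inδ G S)
    count-I∁+count-I≡count-δ = count-+ _ _ _ I∁+I≡δ
      where
      I∁+I≡δ : ∀ e → ⟦ inI G (∁ F) B e ⟧ + ⟦ inI G F B e ⟧ ≡ ⟦ inδ G S e ⟧
      I∁+I≡δ e rewrite lookup-map e not F = I∁+I≡δᵇ (inδ G S e) (lookup F e) (isη G B e) (η⊆δ isB e)

    count-γ∪I≡count-γ+count-I : count (λ e → inγ G S e ∨ inI G F B e) ≡ count (inγ G S) + count (inI G F B)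
    count-γ∪I≡count-γ+count-I = sym (count-+ _ _ _ (λ e → sym (⟦x∨y⟧≡⟦x⟧+⟦y⟧ _ _ (γ∩I≡∅ e))))
      where
      γ∩I≡∅ : ∀ e → inγ G S e ≡ true → inI G F B e ≡ true → ⊥
      γ∩I≡∅ e e∈γ e∈I
        with () ← trans (sym (I⊆δ F e e∈I)) (x∧y⇒¬x⊕y (lookup S (proj₁ (ends e))) (lookup S (proj₂ (ends e))) e∈γ)

    tight-∁ : (f′ : Fin n → ℕ) → (∀ v → f′ v ≤ deg G v) →
      count (λ e → lookup F e ∧ (inγ G S e ∨ inI G F B e)) ≡ (sumOver S f′ + count (inI G F B)) / 2 →
      + count (λ e → lookup (∁ F) e ∧ (inγ G S e ∨ (inδ G S e ∧ not (inI G (∁ F) B e))))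
        ≡ ceilHalf (+ sumOver S (λ v → deg G v ∸ f′ v) - + count (inI G (∁ F) B))
    tight-∁ f′ f′≤deg F-side≡⌊[f′B+i]/2⌋ =
      sym (q*2+b≡a+r⇒ceilHalf[a-b]≡q fB (count (inI G (∁ F) B)) C-side r (m%n<n (f′B + count (inI G F B)) 2)
            (balance {Y = C-side} {a = fB} C+F≡γ+I count-I∁+count-I≡count-δ fB+f′B≡deg F-side*2+r≡f′B+i))
      where
      C-side F-side fB f′B r : ℕ
      C-side = count (λ e → lookup (∁ F) e ∧ (inγ G S e ∨ (inδ G S e ∧ not (inI G (∁ F) B e))))
      F-side = count (λ e → lookup F e ∧ (inγ G S e ∨ inI G F B e))
      fB = sumOver S (λ v → deg G v ∸ f′ v)
      f′B = sumOver S f′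
      r = (f′B + count (inI G F B)) % 2

      C+F≡γ+I : C-side + F-side ≡ count (inγ G S) + count (inI G F B)
      C+F≡γ+I = trans (count-+ _ _ _ split) count-γ∪I≡count-γ+count-I
        where
        split : ∀ e → ⟦ lookup (∁ F) e ∧ (inγ G S e ∨ (inδ G S e ∧ not (inI G (∁ F) B e))) ⟧
                      + ⟦ lookup F e ∧ (inγ G S e ∨ inI G F B e) ⟧ ≡ ⟦ inγ G S e ∨ inI G F B e ⟧
        split e rewrite γ∪δ∖I∁≡γ∪I e | lookup-map e not F =
          ⟦not-x∧y⟧+⟦x∧y⟧≡⟦y⟧ (lookup F e) (inγ G S e ∨ inI G F B e)

      fB+f′B≡deg : fB + f′B ≡ count (inγ G S) * 2 + count (inδ G S)
      fB+f′B≡deg = trans (sumOver-∸+ S f′≤deg) (sumOver-deg S)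

      F-side*2+r≡f′B+i : F-side * 2 + r ≡ f′B + count (inI G F B)
      F-side*2+r≡f′B+i rewrite F-side≡⌊[f′B+i]/2⌋ =
        trans (ℕ.+-comm ((f′B + count (inI G F B)) / 2 * 2) r)
              (sym (m≡m%n+[m/n]*n (f′B + count (inI G F B)) 2))

  yzC∁≡yzF : {R : Set} (0# : R) (_⊕_ : R → R → R) {p : ℕ} (Ω : Fin p → Blossom G)
             (y : Fin n → R) (z : Fin p → R) {F : Subset m} → (∀ j → IsBlossom G F (Ω j)) →
             ∀ e → Duals.yzC G 0# _⊕_ Ω y z (∁ F) e ≡ Duals.yzF G 0# _⊕_ Ω y z F e
  yzC∁≡yzF 0# _⊕_ Ω y z Ω-blossoms e =
    cong ((y (proj₁ (ends e)) ⊕ y (proj₂ (ends e))) ⊕_)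
         (sumIf-cong 0# _⊕_ z (λ j → γ∪δ∖I∁≡γ∪I (Ω-blossoms j) e))

  deficient-∁ : ∀ (F : Subset m) (f′ : Fin n → ℕ) v →
                deg G v ∸ f′ v < degIn G (∁ F) v → degIn G F v < f′ v
  deficient-∁ F f′ v f<deg∁ = ℕ.∸-cancelʳ-< (subst (deg G v ∸ f′ v <_) deg∁≡deg∸degF f<deg∁)
    where
    deg∁≡deg∸degF : degIn G (∁ F) v ≡ deg G v ∸ degIn G F v
    deg∁≡deg∸degF = trans (sym (ℕ.m+n∸m≡n (degIn G F v) (degIn G (∁ F) v)))
                          (cong (_∸ degIn G F v) (degIn+degIn∁≡deg F v))

mainTheorem11 :
  -- values: an arbitrary carrier R with 0, +, - and ≤ (standing in for ℝ)
  {R : Set} (0# : R) (_⊕_ _⊖_ : R → R → R) (_≼_ : R → R → Set) →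
  {n m : ℕ} (G : Multigraph n m) (w : Fin m → R) (f′ : Fin n → ℕ) →
  ((v : Fin n) → f′ v ≤ deg G v) →
  (F : Subset m) → ((v : Fin n) → degIn G F v ≤ f′ v) →
  {p : ℕ} (Ω : Fin p → Blossom G) →
  ((j : Fin p) → IsBlossom G F (Ω j)) →
  Injective _≡_ _≡_ (λ j → tuple G (Ω j)) →
  (y : Fin n → R) → ((v : Fin n) → 0# ≼ y v) →
  (z : Fin p → R) → ((j : Fin p) → 0# ≼ z j) →
  (δ₁′ δ₂′ : R) → 0# ≼ δ₁′ → 0# ≼ δ₂′ →
  -- (F1)
  ((e : Fin m) → lookup F e ≡ false →
     (w e ⊖ δ₁′) ≼ Duals.yzF G 0# _⊕_ Ω y z F e) →
  -- (F2)
  ((e : Fin m) → lookup F e ≡ true →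
     Duals.yzF G 0# _⊕_ Ω y z F e ≼ (w e ⊕ δ₂′)) →
  -- (F3)
  ((j : Fin p) →
     count (λ e → lookup F e ∧ (inγ G (verts G (Ω j)) e ∨ inI G F (Ω j) e))
     ≡ (sumOver (verts G (Ω j)) f′ Data.Nat.+ count (inI G F (Ω j))) / 2) →
  -- (F4)
  ((v : Fin n) → degIn G F v < f′ v → y v ≡ 0#) →
  -- conclusions for C = E ∖ F, f(v) = deg(v) − f′(v), δ₁ = δ₂′, δ₂ = δ₁′
  let C = ∁ F
      f = λ v → deg G v Data.Nat.∸ f′ v
  in
  -- (C1)
  ((e : Fin m) → lookup C e ≡ false →
     Duals.yzC G 0# _⊕_ Ω y z C e ≼ (w e ⊕ δ₂′))
  × -- (C2)
  ((e : Fin m) → lookup C e ≡ true →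
     (w e ⊖ δ₁′) ≼ Duals.yzC G 0# _⊕_ Ω y z C e)
  × -- (C3)
  ((j : Fin p) →
     + count (λ e → lookup C e ∧ (inγ G (verts G (Ω j)) e
                 ∨ (inδ G (verts G (Ω j)) e ∧ not (inI G C (Ω j) e))))
     ≡ ceilHalf (+ sumOver (verts G (Ω j)) f - + count (inI G C (Ω j))))
  × -- (C4)
  ((v : Fin n) → f v < degIn G C v → y v ≡ 0#)
mainTheorem11 0# _⊕_ _⊖_ _≼_ G w f′ f′≤deg F _ Ω Ω-blossoms _ y _ z _ δ₁′ δ₂′ _ _ F1 F2 F3 F4 =
    (λ e e∉C → subst (_≼ (w e ⊕ δ₂′)) (sym (yz≡ e)) (F2 e (lookup-∁ F e true e∉C)))
  , (λ e e∈C → subst ((w e ⊖ δ₁′) ≼_) (sym (yz≡ e)) (F1 e (lookup-∁ F e false e∈C)))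
  , (λ j → tight-∁ G (Ω-blossoms j) f′ f′≤deg (F3 j))
  , (λ v f<deg∁ → F4 v (deficient-∁ G F f′ v f<deg∁))
  where
  yz≡ : ∀ e → Duals.yzC G 0# _⊕_ Ω y z (∁ F) e ≡ Duals.yzF G 0# _⊕_ Ω y z F e
  yz≡ = yzC∁≡yzF G 0# _⊕_ Ω y z Ω-blossoms
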